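{- Let $T:\mathsf{Pre}\to\mathsf{Pre}$ be a locally monotone functor and let $\overline{T}:\mathsf{Rel}(\mathsf{Pre})\to\mathsf{Rel}(\mathsf{Pre})$ be a lifting of $T$, i.e. a 2-functor with $\overline{T}\circ(-)_\diamond=(-)_\diamond\circ T$. Then for every monotone relation $R$, $\overline{T}(R)=(Td_0)_\diamond\cdot(Td_1)^\diamond$, where $(d_0,\mathscr{E},d_1)$ is the two-sided discrete fibration corresponding to $R$.
   Context: Preorders; $\mathscr{A}(a,a')\in\{0,1\}$ is the truth value of $a\le a'$; $\mathbb{2}=\{0\le1\}$. $T$ is locally monotone if $f\le g$ pointwise implies $Tf\le Tg$. $\mathsf{Rel}(\mathsf{Pre})$: objects preorders; a monotone relation $R$ from $\mathscr{B}$ to $\mathscr{A}$ is a monotone map $R:\mathscr{A}^{op}\times\mathscr{B}\to\mathbb{2}$; composition $(S\cdot R)(c,a)=\bigvee_bR(b,a)\wedge S(c,b)$; 2-cells pointwise order. For monotone $f:\mathscr{X}\to\mathscr{Y}$, $f_\diamond(y,x)=\mathscr{Y}(y,fx)$ (relation from $\mathscr{X}$ to $\mathscr{Y}$) and $f^\diamond(x,y)=\mathscr{Y}(fx,y)$ (relation from $\mathscr{Y}$ to $\mathscr{X}$). The fibration corresponding to $R$ from $\mathscr{B}$ to $\mathscr{A}$ is $\mathscr{E}=\{(a,b):R(a,b)=1\}$ with componentwise order and projections $d_0:\mathscr{E}\to\mathscr{A}$, $d_1:\mathscr{E}\to\mathscr{B}$. -}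

module Defs where

open import Level using (0ℓ)
open import Data.Product using (Σ; ∃; _×_; _,_; proj₁; proj₂)
open import Relation.Binary.PropositionalEquality using (_≡_)
open import Relation.Binary.Structures using (IsPreorder)
open import Relation.Binary.Core using (Rel)

-- Preorders (objects of Pre).  The truth value 𝒜(a,a') ∈ 𝟚 is rendered
-- as the type  a ≤ a'  (a proposition up to logical equivalence).

record Pre : Set₁ where
  field
    Carrier    : Set
    _≤_        : Rel Carrier 0ℓ
    isPreorder : IsPreorder _≡_ _≤_
  open IsPreorder isPreorder public using () renaming (refl to ≤-refl; trans to ≤-trans)

open Pre public using (Carrier)

record Mono (𝒳 𝒴 : Pre) : Set where
  open Pre
  field
    fun  : Carrier 𝒳 → Carrier 𝒴
    mono : ∀ {x x'} → _≤_ 𝒳 x x' → _≤_ 𝒴 (fun x) (fun x')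

open Mono public

idMono : (𝒳 : Pre) → Mono 𝒳 𝒳
idMono 𝒳 = record { fun = λ x → x ; mono = λ p → p }

_∘M_ : {𝒳 𝒴 𝒵 : Pre} → Mono 𝒴 𝒵 → Mono 𝒳 𝒴 → Mono 𝒳 𝒵
g ∘M f = record { fun = λ x → fun g (fun f x) ; mono = λ p → mono g (mono f p) }

record Functor : Set₁ where
  field
    obj     : Pre → Pre
    map     : {𝒳 𝒴 : Pre} → Mono 𝒳 𝒴 → Mono (obj 𝒳) (obj 𝒴)
    map-resp : {𝒳 𝒴 : Pre} (f g : Mono 𝒳 𝒴) →
               (∀ x → fun f x ≡ fun g x) → ∀ x → fun (map f) x ≡ fun (map g) x
    map-id  : (𝒳 : Pre) → ∀ x → fun (map (idMono 𝒳)) x ≡ x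
    map-∘   : {𝒳 𝒴 𝒵 : Pre} (g : Mono 𝒴 𝒵) (f : Mono 𝒳 𝒴) →
              ∀ x → fun (map (g ∘M f)) x ≡ fun (map g) (fun (map f) x)

open Functor public

LocallyMonotone : Functor → Set₁
LocallyMonotone T = {𝒳 𝒴 : Pre} (f g : Mono 𝒳 𝒴) →
  (∀ x → Pre._≤_ 𝒴 (fun f x) (fun g x)) →
  ∀ x → Pre._≤_ (obj T 𝒴) (fun (map T f) x) (fun (map T g) x)

-- Monotone relations.  MRel 𝒜 ℬ : a monotone relation FROM ℬ TO 𝒜, i.e.
-- a monotone map 𝒜^op × ℬ → 𝟚, written  rel a b.

record MRel (𝒜 ℬ : Pre) : Set₁ where
  field
    rel  : Carrier 𝒜 → Carrier ℬ → Set
    mono : ∀ {a a' b b'} → Pre._≤_ 𝒜 a' a → Pre._≤_ ℬ b b' → rel a b → rel a' b'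

open MRel public using (rel)

_⊑_ : {𝒜 ℬ : Pre} → MRel 𝒜 ℬ → MRel 𝒜 ℬ → Set
R ⊑ S = ∀ a b → rel R a b → rel S a b

_≐_ : {𝒜 ℬ : Pre} → MRel 𝒜 ℬ → MRel 𝒜 ℬ → Set
R ≐ S = (R ⊑ S) × (S ⊑ R)

idR : (𝒜 : Pre) → MRel 𝒜 𝒜
idR 𝒜 = record
  { rel  = Pre._≤_ 𝒜
  ; mono = λ p q r → Pre.≤-trans 𝒜 p (Pre.≤-trans 𝒜 r q) }

_·_ : {𝒜 ℬ 𝒞 : Pre} → MRel 𝒞 ℬ → MRel ℬ 𝒜 → MRel 𝒞 𝒜
_·_ {ℬ = ℬ} S R = record
  { rel  = λ c a → ∃ λ (b : Carrier ℬ) → rel R b a × rel S c b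
  ; mono = λ p q (b , r , s) →
      b , MRel.mono R (Pre.≤-refl ℬ) q r , MRel.mono S p (Pre.≤-refl ℬ) s }

_⋄ : {𝒳 𝒴 : Pre} → Mono 𝒳 𝒴 → MRel 𝒴 𝒳
_⋄ {𝒴 = 𝒴} f = record
  { rel  = λ y x → Pre._≤_ 𝒴 y (fun f x)
  ; mono = λ p q r → Pre.≤-trans 𝒴 p (Pre.≤-trans 𝒴 r (Mono.mono f q)) }

_^⋄ : {𝒳 𝒴 : Pre} → Mono 𝒳 𝒴 → MRel 𝒳 𝒴
_^⋄ {𝒴 = 𝒴} f = record
  { rel  = λ x y → Pre._≤_ 𝒴 (fun f x) y
  ; mono = λ p q r → Pre.≤-trans 𝒴 (Mono.mono f p) (Pre.≤-trans 𝒴 r q) }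

record Lifting (T : Functor) : Set₁ where
  field
    rmap      : {𝒜 ℬ : Pre} → MRel 𝒜 ℬ → MRel (obj T 𝒜) (obj T ℬ)
    rmap-mono : {𝒜 ℬ : Pre} (R S : MRel 𝒜 ℬ) → R ⊑ S → rmap R ⊑ rmap S
    rmap-id   : (𝒜 : Pre) → rmap (idR 𝒜) ≐ idR (obj T 𝒜)
    rmap-·    : {𝒜 ℬ 𝒞 : Pre} (S : MRel 𝒞 ℬ) (R : MRel ℬ 𝒜) →
                rmap (S · R) ≐ (rmap S · rmap R)
    lifts     : {𝒳 𝒴 : Pre} (f : Mono 𝒳 𝒴) → rmap (f ⋄) ≐ (map T f ⋄)

open Lifting public

module Fibration {𝒜 ℬ : Pre} (R : MRel 𝒜 ℬ) where
  ℰ : Pre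
  ℰ = record
    { Carrier    = Σ (Carrier 𝒜 × Carrier ℬ) (λ p → rel R (proj₁ p) (proj₂ p))
    ; _≤_        = λ e e' → Pre._≤_ 𝒜 (proj₁ (proj₁ e)) (proj₁ (proj₁ e'))
                          × Pre._≤_ ℬ (proj₂ (proj₁ e)) (proj₂ (proj₁ e'))
    ; isPreorder = record
        { isEquivalence = Relation.Binary.PropositionalEquality.isEquivalence
        ; reflexive = λ { Relation.Binary.PropositionalEquality.refl →
                           Pre.≤-refl 𝒜 , Pre.≤-refl ℬ }
        ; trans = λ (p , q) (p' , q') → Pre.≤-trans 𝒜 p p' , Pre.≤-trans ℬ q q' }
    }

  d₀ : Mono ℰ 𝒜
  d₀ = record { fun = λ e → proj₁ (proj₁ e) ; mono = proj₁ }

  d₁ : Mono ℰ ℬ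
  d₁ = record { fun = λ e → proj₂ (proj₁ e) ; mono = proj₂ }

module Submission where

--  * Calculus of relations: composition is monotone in both arguments, so
--    pointwise equivalence ≐ is a congruence for composition and for T̄.
--  * Adjunctions in Rel(Pre): every graph is a left adjoint, f_⋄ ⊣ f^⋄, and
--    f^⋄ is the unique right adjoint of f_⋄.  A 2-functor preserves
--    adjunctions, so T̄(f^⋄) is right adjoint to T̄(f_⋄) ≐ (Tf)_⋄, hence
--    T̄(f^⋄) ≐ (Tf)^⋄: the lifting also commutes with (-)^⋄.
--  * Tabulation: every relation factors through its two-sided discrete
--    fibration, R ≐ (d₀)_⋄ · (d₁)^⋄.
--
-- Applying T̄ to the tabulation and using preservation of composition gives
-- T̄(R) ≐ T̄((d₀)_⋄) · T̄((d₁)^⋄) ≐ (Td₀)_⋄ · (Td₁)^⋄.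

open import Defs
open import Data.Product using (_,_; proj₁; proj₂)

-- The fields of a relation are not
-- injective, so the chain threads its intermediate relations through the
-- indices of an inductive type, from which Agda can read them off.
module ≐-Reasoning {𝒜 ℬ : Pre} where
  infix  1 begin_
  infixr 2 _≐⟨_⟩_
  infix  3 _∎

  data _IsRelatedTo_ (R S : MRel 𝒜 ℬ) : Set where
    relTo : R ≐ S → R IsRelatedTo S

  begin_ : {R S : MRel 𝒜 ℬ} → R IsRelatedTo S → R ≐ S
  begin relTo R≐S = R≐S

  _≐⟨_⟩_ : (R : MRel 𝒜 ℬ) {S U : MRel 𝒜 ℬ} → R ≐ S → S IsRelatedTo U → R IsRelatedTo U
  R ≐⟨ R⊑S , S⊑R ⟩ relTo (S⊑U , U⊑S) =
    relTo ((λ a b r → S⊑U a b (R⊑S a b r)) , (λ a b u → S⊑R a b (U⊑S a b u)))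

  _∎ : (R : MRel 𝒜 ℬ) → R IsRelatedTo R
  R ∎ = relTo ((λ a b r → r) , (λ a b r → r))

⊑-refl : {𝒜 ℬ : Pre} (R : MRel 𝒜 ℬ) → R ⊑ R
⊑-refl R a b r = r

·-mono : {𝒜 ℬ 𝒞 : Pre} (S S' : MRel 𝒞 ℬ) (R R' : MRel ℬ 𝒜) →
         S ⊑ S' → R ⊑ R' → (S · R) ⊑ (S' · R')
·-mono S S' R R' S⊑S' R⊑R' c a (b , r , s) = b , R⊑R' b a r , S⊑S' c b s

·-cong : {𝒜 ℬ 𝒞 : Pre} (S S' : MRel 𝒞 ℬ) (R R' : MRel ℬ 𝒜) →
         S ≐ S' → R ≐ R' → (S · R) ≐ (S' · R')
·-cong S S' R R' (S⊑S' , S'⊑S) (R⊑R' , R'⊑R) =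
  ·-mono S S' R R' S⊑S' R⊑R' , ·-mono S' S R' R S'⊑S R'⊑R

rmap-cong : {T : Functor} (T̄ : Lifting T) {𝒜 ℬ : Pre} (R S : MRel 𝒜 ℬ) →
            R ≐ S → rmap T̄ R ≐ rmap T̄ S
rmap-cong T̄ R S (R⊑S , S⊑R) = rmap-mono T̄ _ _ R⊑S , rmap-mono T̄ _ _ S⊑R

record _⊣_ {𝒳 𝒴 : Pre} (F : MRel 𝒴 𝒳) (G : MRel 𝒳 𝒴) : Set where
  field
    unit   : idR 𝒳 ⊑ (G · F)
    counit : (F · G) ⊑ idR 𝒴

open _⊣_

graph-adjunction : {𝒳 𝒴 : Pre} (f : Mono 𝒳 𝒴) → (f ⋄) ⊣ (f ^⋄)
graph-adjunction {𝒴 = 𝒴} f = record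
  { unit   = λ x x' x≤x' → fun f x' , Pre.≤-refl 𝒴 , Mono.mono f x≤x'
  ; counit = λ y y' (_ , fx≤y' , y≤fx) → Pre.≤-trans 𝒴 y≤fx fx≤y' }

⊣-transport : {𝒳 𝒴 : Pre} {F F' : MRel 𝒴 𝒳} {G : MRel 𝒳 𝒴} →
              F ≐ F' → F ⊣ G → F' ⊣ G
⊣-transport {F = F} {F'} {G} (F⊑F' , F'⊑F) F⊣G = record
  { unit   = λ x x' p → ·-mono G G F F' (⊑-refl G) F⊑F' x x' (unit F⊣G x x' p)
  ; counit = λ y y' h → counit F⊣G y y' (·-mono F' F G G F'⊑F (⊑-refl G) y y' h) }

-- The right adjoint of a graph f_⋄ is necessarily f^⋄: the counit at (f x, y)
-- gives f x ≤ y from G(x,y), and the unit at (x,x) gives G(x,y) from f x ≤ y.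
right-adjoint-unique : {𝒳 𝒴 : Pre} (f : Mono 𝒳 𝒴) {G : MRel 𝒳 𝒴} →
                       (f ⋄) ⊣ G → G ≐ (f ^⋄)
right-adjoint-unique {𝒳} {𝒴} f {G} f⋄⊣G = G⊑f^⋄ , f^⋄⊑G
  where
    G⊑f^⋄ : G ⊑ (f ^⋄)
    G⊑f^⋄ x y g = counit f⋄⊣G (fun f x) y (x , g , Pre.≤-refl 𝒴)

    f^⋄⊑G : (f ^⋄) ⊑ G
    f^⋄⊑G x y fx≤y with unit f⋄⊣G x x (Pre.≤-refl 𝒳)
    ... | y₀ , y₀≤fx , g = MRel.mono G (Pre.≤-refl 𝒳) (Pre.≤-trans 𝒴 y₀≤fx fx≤y) g

rmap-preserves-⊣ : {T : Functor} (T̄ : Lifting T) {𝒳 𝒴 : Pre}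
                   {F : MRel 𝒴 𝒳} {G : MRel 𝒳 𝒴} → F ⊣ G → rmap T̄ F ⊣ rmap T̄ G
rmap-preserves-⊣ T̄ {𝒳} {𝒴} {F} {G} F⊣G = record
  { unit   = λ x x' p →
      proj₁ (rmap-· T̄ G F) x x'
        (rmap-mono T̄ _ _ (unit F⊣G) x x' (proj₂ (rmap-id T̄ 𝒳) x x' p))
  ; counit = λ y y' h →
      proj₁ (rmap-id T̄ 𝒴) y y'
        (rmap-mono T̄ _ _ (counit F⊣G) y y' (proj₂ (rmap-· T̄ F G) y y' h)) }

-- A lifting commutes with (-)^⋄ as well: T̄(f^⋄) is right adjoint to
-- T̄(f_⋄) ≐ (Tf)_⋄, so it is (Tf)^⋄.
lifts^⋄ : {T : Functor} (T̄ : Lifting T) {𝒳 𝒴 : Pre} (f : Mono 𝒳 𝒴) →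
          rmap T̄ (f ^⋄) ≐ (map T f ^⋄)
lifts^⋄ {T} T̄ f =
  right-adjoint-unique (map T f)
    (⊣-transport (lifts T̄ f) (rmap-preserves-⊣ T̄ (graph-adjunction f)))

tabulation : {𝒜 ℬ : Pre} (R : MRel 𝒜 ℬ) →
             R ≐ ((Fibration.d₀ R ⋄) · (Fibration.d₁ R ^⋄))
tabulation {𝒜} {ℬ} R =
  (λ a b r → ((a , b) , r) , Pre.≤-refl ℬ , Pre.≤-refl 𝒜) ,
  (λ a b ((_ , r) , b'≤b , a≤a') → MRel.mono R a≤a' b'≤b r)

corollary5p4 : (T : Functor) → LocallyMonotone T → (T̄ : Lifting T) →
    {𝒜 ℬ : Pre} (R : MRel 𝒜 ℬ) →
    rmap T̄ R ≐ ((map T (Fibration.d₀ R) ⋄) · (map T (Fibration.d₁ R) ^⋄))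
corollary5p4 T _ T̄ R = begin
    rmap T̄ R                                  ≐⟨ rmap-cong T̄ R _ (tabulation R) ⟩
    rmap T̄ ((d₀ ⋄) · (d₁ ^⋄))                 ≐⟨ rmap-· T̄ (d₀ ⋄) (d₁ ^⋄) ⟩
    rmap T̄ (d₀ ⋄) · rmap T̄ (d₁ ^⋄)            ≐⟨ ·-cong (rmap T̄ (d₀ ⋄)) (map T d₀ ⋄)
                                                   (rmap T̄ (d₁ ^⋄)) (map T d₁ ^⋄)
                                                   (lifts T̄ d₀) (lifts^⋄ T̄ d₁) ⟩
    (map T d₀ ⋄) · (map T d₁ ^⋄)              ∎
  where
    open Fibration R
    open ≐-Reasoning
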